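{- Let $d\geq 2$ be an integer and let $r=\operatorname{ord}_3(d)$ be the $3$-adic valuation of $d$, and suppose $r\geq 2$. Suppose integers $x,y$ and an integer $n\geq 2$ satisfy \[ d\left(\left(x+\frac{d+1}{2}\right)^2+\frac{(d-1)(d+1)}{12}\right)=y^n, \] (equivalently, $(x+1)^2+(x+2)^2+\cdots+(x+d)^2=y^n$). Then $n$ divides $r-1$. -}

module Defs where

open import Data.Nat using (ℕ; zero; suc; _^_)
open import Data.Nat.Divisibility using (_∣_)
open import Data.Integer using (ℤ; +_; _+_; _*_)
open import Data.Product using (_×_)
open import Relation.Nullary using (¬_)

Ord3 : ℕ → ℕ → Set
Ord3 d r = (3 ^ r ∣ d) × ¬ (3 ^ suc r ∣ d)

sumSq : ℤ → ℕ → ℤ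
sumSq x zero    = + 0
sumSq x (suc k) = sumSq x k + (x + + suc k) * (x + + suc k)

{-# OPTIONS --safe #-}
-- Six times the sum of squares is d · Q(x, d), where Q(x, k) = 6x² + 6(k + 1)x + (k + 1)(2k + 1)
-- is `cofactor` below.  Writing d = 3ʳ q with 3 ∤ q, the equation becomes 2 yⁿ = 3ʳ⁻¹ q Q(x, d),
-- and Q(x, d) ≡ 1 + 2d² ≡ 1 (mod 3) since 3 ∣ d.  So the 3-adic valuation of yⁿ, a multiple of n,
-- is exactly r − 1.
module Submission where

open import Defs
open import Data.Nat using (ℕ; _≤_; _∸_)
open import Data.Nat.Divisibility using (_∣_)
open import Data.Integer using (ℤ) renaming (_^_ to _^ℤ_)
open import Relation.Binary.PropositionalEquality using (_≡_)

open import Data.Nat as ℕ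
  using (zero; suc; _*_; _^_; _<_; NonZero; NonTrivial; nonTrivial⇒≢1; nonTrivial⇒nonZero)
open import Data.Nat.Properties
  using (*-assoc; *-identityˡ; *-zeroʳ; *-cancelˡ-≡; ^-*-assoc; m^n≢0; m*n≡0⇒m≡0∨n≡0)
open import Data.Nat.Divisibility
  using (divides; quotient; _∣?_; quotient-<; quotient≢0; m∣n⇒n≡quotient*m; ∣1⇒≡1;
         m∣m*n; *-monoˡ-∣; ∣-trans; _∣0)
open import Data.Nat.Primality using (Prime; prime?; euclidsLemma)
open import Data.Nat.Induction using (<-rec)
import Data.Nat.Tactic.RingSolver as ℕ-Solver
open import Data.Integer using (+_; ∣_∣) renaming (_+_ to _+ℤ_; _*_ to _*ℤ_)
open import Data.Integer.Properties using (abs-*; *-distribˡ-+)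
import Data.Integer.Divisibility.Signed as Signed
import Data.Integer.Tactic.RingSolver as ℤ-Solver
open import Data.Product using (_,_; ∃₂; _×_)
open import Data.Sum using (inj₁; inj₂)
open import Relation.Nullary using (¬_; yes; no; contradiction)
open import Relation.Nullary.Decidable using (from-yes; from-no)
open import Relation.Binary.PropositionalEquality
  using (refl; sym; trans; cong; subst; module ≡-Reasoning)

^-distribʳ-* : ∀ a b n → (a * b) ^ n ≡ a ^ n * b ^ n
^-distribʳ-* a b zero    = refl
^-distribʳ-* a b (suc n) = begin
  a * b * (a * b) ^ n      ≡⟨ cong (a * b *_) (^-distribʳ-* a b n) ⟩
  a * b * (a ^ n * b ^ n)  ≡⟨ interchange a b (a ^ n) (b ^ n) ⟩
  a * a ^ n * (b * b ^ n)  ∎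
  where
  open ≡-Reasoning
  interchange : ∀ a b c d → a * b * (c * d) ≡ a * c * (b * d)
  interchange = ℕ-Solver.solve-∀

abs-^ : ∀ i n → ∣ i ^ℤ n ∣ ≡ ∣ i ∣ ^ n
abs-^ i zero    = refl
abs-^ i (suc n) = trans (abs-* i (i ^ℤ n)) (cong (∣ i ∣ *_) (abs-^ i n))

p^[1+r]∤d⇒p∤quotient : ∀ {p r d} (pʳ∣d : p ^ r ∣ d) → ¬ p ^ suc r ∣ d → ¬ p ∣ quotient pʳ∣d
p^[1+r]∤d⇒p∤quotient {p} {r} pʳ∣d pʳ⁺¹∤d p∣q =
  pʳ⁺¹∤d (subst (p ^ suc r ∣_) (sym (m∣n⇒n≡quotient*m pʳ∣d)) (*-monoˡ-∣ (p ^ r) p∣q))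

module _ {p : ℕ} .{{_ : NonTrivial p}} where

  PowerTimesCoprime : ℕ → Set
  PowerTimesCoprime Y = ∃₂ λ k z → ¬ p ∣ z × Y ≡ p ^ k * z

  p-adic-factorisation : ∀ Y → .{{NonZero Y}} → PowerTimesCoprime Y
  p-adic-factorisation = <-rec (λ Y → .{{NonZero Y}} → PowerTimesCoprime Y) go
    where
    go : ∀ Y → (∀ {W} → W < Y → .{{NonZero W}} → PowerTimesCoprime W) →
         .{{NonZero Y}} → PowerTimesCoprime Y
    go Y rec with p ∣? Y
    ... | no  p∤Y = 0 , Y , p∤Y , sym (*-identityˡ Y)
    ... | yes p∣Y with rec (quotient-< p∣Y) {{quotient≢0 p∣Y}}
    ...   | k , z , p∤z , W≡pᵏz = suc k , z , p∤z , (begin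
      Y                 ≡⟨ m∣n⇒n≡quotient*m p∣Y ⟩
      quotient p∣Y * p  ≡⟨ cong (_* p) W≡pᵏz ⟩
      p ^ k * z * p     ≡⟨ rotate p (p ^ k) z ⟩
      p * p ^ k * z     ∎)
      where
      open ≡-Reasoning
      rotate : ∀ p t z → t * z * p ≡ p * t * z
      rotate = ℕ-Solver.solve-∀

module _ {p : ℕ} .{{_ : NonZero p}} where

  p^a*u≡p^b*v⇒a≡b : ∀ a b {u v} → ¬ p ∣ u → ¬ p ∣ v → p ^ a * u ≡ p ^ b * v → a ≡ b
  p^a*u≡p^b*v⇒a≡b zero    zero    p∤u p∤v eq = refl
  p^a*u≡p^b*v⇒a≡b zero    (suc b) {u} {v} p∤u p∤v eq =
    contradiction (subst (p ∣_) p*pᵇv≡u (m∣m*n _)) p∤u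
    where
    p*pᵇv≡u : p * (p ^ b * v) ≡ u
    p*pᵇv≡u = trans (sym (*-assoc p (p ^ b) v)) (trans (sym eq) (*-identityˡ u))
  p^a*u≡p^b*v⇒a≡b (suc a) zero    p∤u p∤v eq = sym (p^a*u≡p^b*v⇒a≡b zero (suc a) p∤v p∤u (sym eq))
  p^a*u≡p^b*v⇒a≡b (suc a) (suc b) {u} {v} p∤u p∤v eq =
    cong suc (p^a*u≡p^b*v⇒a≡b a b p∤u p∤v
      (*-cancelˡ-≡ _ _ p (trans (sym (*-assoc p (p ^ a) u)) (trans eq (*-assoc p (p ^ b) v)))))

module _ {p : ℕ} (p-prime : Prime p) where

  open Prime p-prime using (nontrivial)

  private instance
    p≢0 : NonZero p
    p≢0 = nonTrivial⇒nonZero p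

  ¬∣-* : ∀ {a b} → ¬ p ∣ a → ¬ p ∣ b → ¬ p ∣ a * b
  ¬∣-* {a} {b} p∤a p∤b p∣ab with euclidsLemma a b p-prime p∣ab
  ... | inj₁ p∣a = p∤a p∣a
  ... | inj₂ p∣b = p∤b p∣b

  ¬∣-^ : ∀ {a} n → ¬ p ∣ a → ¬ p ∣ a ^ n
  ¬∣-^ zero    p∤a p∣1 = nonTrivial⇒≢1 (∣1⇒≡1 p∣1)
  ¬∣-^ (suc n) p∤a     = ¬∣-* p∤a (¬∣-^ n p∤a)

  c*Yⁿ≡pˢ*m⇒n∣s : ∀ {c m s Y} n .{{_ : NonZero n}} → ¬ p ∣ c → ¬ p ∣ m →
                  c * Y ^ n ≡ p ^ s * m → n ∣ s
  c*Yⁿ≡pˢ*m⇒n∣s {c} {m} {s} {zero} n@(suc _) p∤c p∤m eq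
    with m*n≡0⇒m≡0∨n≡0 (p ^ s) (trans (sym eq) (*-zeroʳ c))
  ... | inj₁ pˢ≡0 = contradiction pˢ≡0 (ℕ.≢-nonZero⁻¹ _ {{m^n≢0 p s}})
  ... | inj₂ refl = contradiction (p ∣0) p∤m
  c*Yⁿ≡pˢ*m⇒n∣s {c} {m} {s} {Y@(suc _)} n p∤c p∤m eq
    with p-adic-factorisation Y
  ... | k , z , p∤z , Y≡pᵏz =
    divides k (sym (p^a*u≡p^b*v⇒a≡b (k * n) s (¬∣-* p∤c (¬∣-^ n p∤z)) p∤m
                                    (trans (sym regroup) eq)))
    where
    open ≡-Reasoning
    swap : ∀ a b c → a * (b * c) ≡ b * (a * c)
    swap = ℕ-Solver.solve-∀
    regroup : c * Y ^ n ≡ p ^ (k * n) * (c * z ^ n)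
    regroup = begin
      c * Y ^ n                  ≡⟨ cong (λ t → c * t ^ n) Y≡pᵏz ⟩
      c * (p ^ k * z) ^ n        ≡⟨ cong (c *_) (^-distribʳ-* (p ^ k) z n) ⟩
      c * ((p ^ k) ^ n * z ^ n)  ≡⟨ cong (λ t → c * (t * z ^ n)) (^-*-assoc p k n) ⟩
      c * (p ^ (k * n) * z ^ n)  ≡⟨ swap c (p ^ (k * n)) (z ^ n) ⟩
      p ^ (k * n) * (c * z ^ n)  ∎

-- The paper's 6((x + (k + 1)/2)² + (k² − 1)/12), cleared of denominators.
cofactor : ℤ → ℤ → ℤ
cofactor x k = + 6 *ℤ x *ℤ x +ℤ + 6 *ℤ (k +ℤ + 1) *ℤ x +ℤ (k +ℤ + 1) *ℤ (+ 2 *ℤ k +ℤ + 1)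

-- The ring solver does not unfold `cofactor`, hence the `expanded` restatements below.
sumSq-closedForm : ∀ x k → + 6 *ℤ sumSq x k ≡ + k *ℤ cofactor x (+ k)
sumSq-closedForm x zero    = refl
sumSq-closedForm x (suc k) = begin
  + 6 *ℤ (sumSq x k +ℤ square)              ≡⟨ *-distribˡ-+ (+ 6) (sumSq x k) square ⟩
  + 6 *ℤ sumSq x k +ℤ + 6 *ℤ square         ≡⟨ cong (_+ℤ + 6 *ℤ square) (sumSq-closedForm x k) ⟩
  + k *ℤ cofactor x (+ k) +ℤ + 6 *ℤ square  ≡⟨ expanded x (+ k) ⟩
  + suc k *ℤ cofactor x (+ suc k)           ∎
  where
  open ≡-Reasoning
  square = (x +ℤ + suc k) *ℤ (x +ℤ + suc k)
  expanded : ∀ x k →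
    k *ℤ (+ 6 *ℤ x *ℤ x +ℤ + 6 *ℤ (k +ℤ + 1) *ℤ x +ℤ (k +ℤ + 1) *ℤ (+ 2 *ℤ k +ℤ + 1))
      +ℤ + 6 *ℤ ((x +ℤ (+ 1 +ℤ k)) *ℤ (x +ℤ (+ 1 +ℤ k))) ≡
    (+ 1 +ℤ k) *ℤ (+ 6 *ℤ x *ℤ x +ℤ + 6 *ℤ ((+ 1 +ℤ k) +ℤ + 1) *ℤ x
      +ℤ ((+ 1 +ℤ k) +ℤ + 1) *ℤ (+ 2 *ℤ (+ 1 +ℤ k) +ℤ + 1))
  expanded = ℤ-Solver.solve-∀

cofactor≡1+3w+2k² : ∀ x k →
  cofactor x k ≡ + 1 +ℤ + 3 *ℤ (+ 2 *ℤ x *ℤ x +ℤ + 2 *ℤ (k +ℤ + 1) *ℤ x +ℤ k) +ℤ + 2 *ℤ (k *ℤ k)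
cofactor≡1+3w+2k² = expanded
  where
  expanded : ∀ x k →
    + 6 *ℤ x *ℤ x +ℤ + 6 *ℤ (k +ℤ + 1) *ℤ x +ℤ (k +ℤ + 1) *ℤ (+ 2 *ℤ k +ℤ + 1) ≡
    + 1 +ℤ + 3 *ℤ (+ 2 *ℤ x *ℤ x +ℤ + 2 *ℤ (k +ℤ + 1) *ℤ x +ℤ k) +ℤ + 2 *ℤ (k *ℤ k)
  expanded = ℤ-Solver.solve-∀

3∤∣cofactor∣ : ∀ x {k} → 3 ∣ k → ¬ 3 ∣ ∣ cofactor x (+ k) ∣
3∤∣cofactor∣ x {k} 3∣k 3∣cofactor = from-no (3 ∣? 1) (Signed.∣⇒∣ᵤ {+ 3} {+ 1} 3∣1)
  where
  w = + 2 *ℤ x *ℤ x +ℤ + 2 *ℤ (+ k +ℤ + 1) *ℤ x +ℤ + k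
  3∣1+3w+2k² : + 3 Signed.∣ + 1 +ℤ + 3 *ℤ w +ℤ + 2 *ℤ (+ k *ℤ + k)
  3∣1+3w+2k² = subst (+ 3 Signed.∣_) (cofactor≡1+3w+2k² x (+ k)) (Signed.∣ᵤ⇒∣ 3∣cofactor)
  3∣2k² : + 3 Signed.∣ + 2 *ℤ (+ k *ℤ + k)
  3∣2k² = Signed.∣n⇒∣m*n (+ 2) (Signed.∣m⇒∣m*n (+ k) (Signed.∣ᵤ⇒∣ {+ 3} {+ k} 3∣k))
  3∣1 : + 3 Signed.∣ + 1
  3∣1 = Signed.∣m+n∣n⇒∣m (Signed.∣m+n∣n⇒∣m 3∣1+3w+2k² 3∣2k²) (Signed.∣m⇒∣m*n w Signed.∣-refl)

6∣y∣ⁿ≡d*∣cofactor∣ : ∀ x d y n → sumSq x d ≡ y ^ℤ n → 6 * ∣ y ∣ ^ n ≡ d * ∣ cofactor x (+ d) ∣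
6∣y∣ⁿ≡d*∣cofactor∣ x d y n sumSq≡yⁿ = begin
  6 * ∣ y ∣ ^ n                ≡⟨ cong (6 *_) (abs-^ y n) ⟨
  6 * ∣ y ^ℤ n ∣               ≡⟨ abs-* (+ 6) (y ^ℤ n) ⟨
  ∣ + 6 *ℤ y ^ℤ n ∣            ≡⟨ cong (λ t → ∣ + 6 *ℤ t ∣) sumSq≡yⁿ ⟨
  ∣ + 6 *ℤ sumSq x d ∣         ≡⟨ cong ∣_∣ (sumSq-closedForm x d) ⟩
  ∣ + d *ℤ cofactor x (+ d) ∣  ≡⟨ abs-* (+ d) (cofactor x (+ d)) ⟩
  d * ∣ cofactor x (+ d) ∣     ∎
  where open ≡-Reasoning

lemma2p3 : (d r : ℕ) → 2 ≤ d → Ord3 d r → 2 ≤ r →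
           (x y : ℤ) (n : ℕ) → 2 ≤ n →
           sumSq x d ≡ y ^ℤ n →
           n ∣ r ∸ 1
lemma2p3 d (suc s) _ (3ʳ∣d , 3ʳ⁺¹∤d) _ x y n@(suc _) _ sumSq≡yⁿ =
  c*Yⁿ≡pˢ*m⇒n∣s prime[3] {Y = ∣ y ∣} n (from-no (3 ∣? 2)) 3∤q*C 2∣y∣ⁿ≡3ˢ*[q*C]
  where
  prime[3] : Prime 3
  prime[3] = from-yes (prime? 3)
  q = quotient 3ʳ∣d
  C = ∣ cofactor x (+ d) ∣
  3∤q*C : ¬ 3 ∣ q * C
  3∤q*C = ¬∣-* prime[3] {q} {C} (p^[1+r]∤d⇒p∤quotient {3} {suc s} 3ʳ∣d 3ʳ⁺¹∤d)
                                 (3∤∣cofactor∣ x (∣-trans (m∣m*n (3 ^ s)) 3ʳ∣d))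
  2∣y∣ⁿ≡3ˢ*[q*C] : 2 * ∣ y ∣ ^ n ≡ 3 ^ s * (q * C)
  2∣y∣ⁿ≡3ˢ*[q*C] = *-cancelˡ-≡ _ _ 3 (begin
    3 * (2 * ∣ y ∣ ^ n)    ≡⟨ *-assoc 3 2 (∣ y ∣ ^ n) ⟨
    6 * ∣ y ∣ ^ n          ≡⟨ 6∣y∣ⁿ≡d*∣cofactor∣ x d y n sumSq≡yⁿ ⟩
    d * C                  ≡⟨ cong (_* C) (m∣n⇒n≡quotient*m 3ʳ∣d) ⟩
    q * (3 * 3 ^ s) * C    ≡⟨ regroup q (3 ^ s) C ⟩
    3 * (3 ^ s * (q * C))  ∎)
    where
    open ≡-Reasoning
    regroup : ∀ q t C → q * (3 * t) * C ≡ 3 * (t * (q * C))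
    regroup = ℕ-Solver.solve-∀
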